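{- There exists a set $A$ of positive integers which contains no three-term geometric progression with integer ratio and whose upper density satisfies $\bar{d}(A) > 0.815509$. Consequently $\overline{\beta} > 0.815509$.
   Context: A three-term geometric progression with integer ratio is a triple $(a, ak, ak^2)$ of positive integers with $k \geq 2$ an integer. $\bar d(A)=\limsup_{N\to\infty}|A\cap\{1,\dots,N\}|/N$ is the upper density. $\overline{\beta}$ is the supremum of $\bar{d}(A)$ over all sets $A\subset\mathbb{N}$ containing no three-term geometric progression with integer ratio. -}

module Defs where

open import Data.Nat using (ℕ; zero; suc; _+_; _*_; _≤_; _≥_; _>_)
open import Data.Bool using (Bool; true; false)
open import Data.Product using (Σ; _×_; ∃-syntax)
open import Relation.Nullary using (¬_)
open import Relation.Binary.PropositionalEquality using (_≡_)

Subset : Set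
Subset = ℕ → Bool

count : Subset → ℕ → ℕ
count A zero = zero
count A (suc N) with A (suc N)
... | true  = suc (count A N)
... | false = count A N

PositiveSet : Subset → Set
PositiveSet A = A 0 ≡ false

NoGP3 : Subset → Set
NoGP3 A = ∀ (a k : ℕ) → a ≥ 1 → k ≥ 2 →
  ¬ (A a ≡ true × A (a * k) ≡ true × A (a * k * k) ≡ true)

-- Upper density of A strictly exceeds the rational c / d:
-- limsup |A ∩ [1,N]| / N > c/d  iff  there is a rational p/q > c/d
-- with |A ∩ [1,N]| / N ≥ p/q for infinitely many N.
UpperDensityGt : Subset → ℕ → ℕ → Set
UpperDensityGt A c d =
  ∃[ p ] ∃[ q ] (q ≥ 1 × p * d > c * q ×
    (∀ (M : ℕ) → ∃[ N ] (N ≥ M × N ≥ 1 × count A N * q ≥ p * N)))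

{-# OPTIONS --safe #-}
module Submission where

-- The set A is a union of blocks s · B, where B is a union of six intervals inside (90, 4320] of
-- relative measure 3523/4320 > 0.815509, and s runs through scales s₀ = 1, sⱼ₊₁ = 207360 sⱼ²
-- growing so fast that the square of the top of one block is at most the bottom of the next.
-- A progression a, ak, ak² inside a single block has k² < 48, so k ≤ 6, and for those five ratios
-- the intervals of B are checked by computation to admit no progression. A progression spread
-- over several blocks is impossible: its last term ak² is at most (ak)², so it cannot jump past
-- a gap, and if only a lies in a lower block then k < 48 forces ak below the next block.

open import Defs
open import Data.Bool using (true; false)
open import Data.Bool.Properties using (T-≡)
open import Data.List using (List; []; _∷_; map)
open import Data.Nat.ListAction using (sum)
open import Data.List.Membership.Propositional using (find)
open import Data.List.Relation.Unary.All using (All; all?; lookup)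
open import Data.List.Relation.Unary.Any using (Any; here; there; any?)
open import Data.List.Relation.Unary.Any.Properties using (map⁻)
open import Data.Nat
open import Data.Nat.Properties
open import Data.Nat.Tactic.RingSolver using (solve-∀)
open import Data.Product using (∃-syntax; _×_; _,_; proj₁; proj₂)
open import Data.Sum using (inj₁; inj₂)
open import Data.Unit using (⊤; tt)
open import Function using (_∘_)
open import Function.Bundles using (Equivalence)
open import Relation.Binary.Definitions using (tri<; tri≈; tri>)
open import Relation.Binary.PropositionalEquality
  using (_≡_; refl; sym; trans; cong; cong₂; subst; module ≡-Reasoning)
open import Relation.Nullary using (¬_; Dec; yes)
open import Relation.Nullary.Decidable using (⌊_⌋; toWitness; fromWitness; _×-dec_; _→-dec_)

Interval : Set
Interval = ℕ × ℕ

infixl 7 _*ᵢ_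
infixr 6 _∩ᵢ_
infix 4 _∈ᵢ_ _∈ᵢ?_ _⊆ᵢ_

_∈ᵢ_ : ℕ → Interval → Set
n ∈ᵢ (l , u) = l < n × n ≤ u

_∈ᵢ?_ : ∀ n I → Dec (n ∈ᵢ I)
n ∈ᵢ? (l , u) = l <? n ×-dec n ≤? u

_*ᵢ_ : Interval → ℕ → Interval
(l , u) *ᵢ k = l * k , u * k

-- ⊔′ and ⊓′ compare with the builtin _<ᵇ_; with the unary ⊔ and ⊓ the finite checks below
-- on endpoints up to 155520 would not be feasible.
_∩ᵢ_ : Interval → Interval → Interval
(l , u) ∩ᵢ (l′ , u′) = l ⊔′ l′ , u ⊓′ u′

_⊆ᵢ_ : Interval → Interval → Set
(l , u) ⊆ᵢ (l′ , u′) = l′ ≤ l × u ≤ u′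

_⊆ᵢ?_ : ∀ I J → Dec (I ⊆ᵢ J)
(l , u) ⊆ᵢ? (l′ , u′) = l′ ≤? l ×-dec u ≤? u′

Empty : Interval → Set
Empty (l , u) = u ≤ l

empty? : ∀ I → Dec (Empty I)
empty? (l , u) = u ≤? l

length : Interval → ℕ
length (l , u) = u ∸ l

total : List Interval → ℕ
total Is = sum (map length Is)

∈ᵢ-*ᵢ : ∀ {n} I k .{{_ : NonZero k}} → n ∈ᵢ I → n * k ∈ᵢ I *ᵢ k
∈ᵢ-*ᵢ _ k (l<n , n≤u) = *-monoˡ-< k l<n , *-monoˡ-≤ k n≤u

∈ᵢ-∩ᵢ : ∀ {n} I J → n ∈ᵢ I → n ∈ᵢ J → n ∈ᵢ I ∩ᵢ J
∈ᵢ-∩ᵢ (l , u) (l′ , u′) (l<n , n≤u) (l′<n , n≤u′) =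
  subst (_< _) (⊔≡⊔′ l l′) (⊔-pres-<m l<n l′<n) , subst (_ ≤_) (⊓≡⊓′ u u′) (⊓-glb n≤u n≤u′)

∈ᵢ-⊆ᵢ : ∀ {n} I J → I ⊆ᵢ J → n ∈ᵢ I → n ∈ᵢ J
∈ᵢ-⊆ᵢ _ _ (l′≤l , u≤u′) (l<n , n≤u) = ≤-<-trans l′≤l l<n , ≤-trans n≤u u≤u′

Empty⇒∉ᵢ : ∀ {n} I → Empty I → ¬ n ∈ᵢ I
Empty⇒∉ᵢ _ u≤l (l<n , n≤u) = <⇒≱ l<n (≤-trans n≤u u≤l)

Empty-*ᵢ : ∀ I k → Empty I → Empty (I *ᵢ k)
Empty-*ᵢ _ k u≤l = *-monoˡ-≤ k u≤l

⊆ᵢ-*ᵢ : ∀ I J k → I ⊆ᵢ J → I *ᵢ k ⊆ᵢ J *ᵢ k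
⊆ᵢ-*ᵢ _ _ k (l′≤l , u≤u′) = *-monoˡ-≤ k l′≤l , *-monoˡ-≤ k u≤u′

*ᵢ-∩ᵢ : ∀ I J k → (I ∩ᵢ J) *ᵢ k ≡ I *ᵢ k ∩ᵢ J *ᵢ k
*ᵢ-∩ᵢ (l , u) (l′ , u′) k = cong₂ _,_ (begin
    (l ⊔′ l′) * k         ≡⟨ cong (_* k) (⊔≡⊔′ l l′) ⟨
    (l ⊔ l′) * k          ≡⟨ *-distribʳ-⊔ k l l′ ⟩
    l * k ⊔ l′ * k        ≡⟨ ⊔≡⊔′ (l * k) (l′ * k) ⟩
    l * k ⊔′ l′ * k       ∎) (begin
    (u ⊓′ u′) * k         ≡⟨ cong (_* k) (⊓≡⊓′ u u′) ⟨
    (u ⊓ u′) * k          ≡⟨ *-distribʳ-⊓ k u u′ ⟩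
    (u * k) ⊓ (u′ * k)    ≡⟨ ⊓≡⊓′ (u * k) (u′ * k) ⟩
    (u * k) ⊓′ (u′ * k)   ∎)
  where open ≡-Reasoning

*ᵢ-comm : ∀ I j k → I *ᵢ j *ᵢ k ≡ I *ᵢ k *ᵢ j
*ᵢ-comm (l , u) j k = cong₂ _,_ (right-comm l) (right-comm u)
  where
  right-comm : ∀ m → m * j * k ≡ m * k * j
  right-comm m = trans (*-assoc m j k) (trans (cong (m *_) (*-comm j k)) (sym (*-assoc m k j)))

total-*ᵢ : ∀ Is k → total (map (_*ᵢ k) Is) ≡ total Is * k
total-*ᵢ [] k = refl
total-*ᵢ ((l , u) ∷ Is) k = begin
  u * k ∸ l * k + total (map (_*ᵢ k) Is) ≡⟨ cong₂ _+_ (sym (*-distribʳ-∸ k u l)) (total-*ᵢ Is k) ⟩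
  (u ∸ l) * k + total Is * k              ≡⟨ *-distribʳ-+ k (u ∸ l) (total Is) ⟨
  (u ∸ l + total Is) * k                  ∎
  where open ≡-Reasoning

count-suc : ∀ A N → count A N ≤ count A (suc N)
count-suc A N with A (suc N)
... | true  = n≤1+n _
... | false = ≤-refl

count-suc-∈ : ∀ A N → A (suc N) ≡ true → count A (suc N) ≡ suc (count A N)
count-suc-∈ A N _ with A (suc N)
count-suc-∈ A N refl | true = refl

count-mono : ∀ A {m n} → m ≤ n → count A m ≤ count A n
count-mono A = go ∘ ≤⇒≤′
  where
  go : ∀ {m n} → m ≤′ n → count A m ≤ count A n
  go ≤′-refl         = ≤-refl
  go (≤′-step m≤′n) = ≤-trans (go m≤′n) (count-suc A _)

count-interval : ∀ A {l u} → l ≤′ u → (∀ {n} → n ∈ᵢ (l , u) → A n ≡ true) →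
  length (l , u) + count A l ≤ count A u
count-interval A {l} ≤′-refl _ = ≤-reflexive (cong (_+ count A l) (n∸n≡0 l))
count-interval A {l} {suc u} (≤′-step l≤′u) ⊆A = begin
  suc u ∸ l + count A l   ≡⟨ cong (_+ count A l) (+-∸-assoc 1 (≤′⇒≤ l≤′u)) ⟩
  suc (u ∸ l + count A l) ≤⟨ s≤s (count-interval A l≤′u (λ (l<n , n≤u) → ⊆A (l<n , m≤n⇒m≤1+n n≤u))) ⟩
  suc (count A u)         ≡⟨ count-suc-∈ A u (⊆A (s≤s (≤′⇒≤ l≤′u) , ≤-refl)) ⟨
  count A (suc u)         ∎
  where open ≤-Reasoning

Descending : ℕ → List Interval → Set
Descending N []             = ⊤
Descending N ((l , u) ∷ Is) = l ≤ u × u ≤ N × Descending l Is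

descending? : ∀ N Is → Dec (Descending N Is)
descending? N []             = yes tt
descending? N ((l , u) ∷ Is) = l ≤? u ×-dec u ≤? N ×-dec descending? l Is

Descending-*ᵢ : ∀ {N} Is k → Descending N Is → Descending (N * k) (map (_*ᵢ k) Is)
Descending-*ᵢ []             k _                  = tt
Descending-*ᵢ ((l , u) ∷ Is) k (l≤u , u≤N , desc) =
  *-monoˡ-≤ k l≤u , *-monoˡ-≤ k u≤N , Descending-*ᵢ Is k desc

count-≥-total : ∀ A {N} Is → Descending N Is → (∀ {n} → Any (n ∈ᵢ_) Is → A n ≡ true) →
  total Is ≤ count A N
count-≥-total A     []             _                  _  = z≤n
count-≥-total A {N} ((l , u) ∷ Is) (l≤u , u≤N , desc) ⊆A = begin
  u ∸ l + total Is  ≤⟨ +-monoʳ-≤ (u ∸ l) (count-≥-total A Is desc (⊆A ∘ there)) ⟩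
  u ∸ l + count A l ≤⟨ count-interval A (≤⇒≤′ l≤u) (⊆A ∘ here) ⟩
  count A u         ≤⟨ count-mono A u≤N ⟩
  count A N         ∎
  where open ≤-Reasoning

NoGPWithRatio : ℕ → List Interval → Set
NoGPWithRatio k Is = All (λ I → All (λ J → All (λ K → Empty (I *ᵢ k *ᵢ k ∩ᵢ J *ᵢ k ∩ᵢ K)) Is) Is) Is

noGPWithRatio? : ∀ k Is → Dec (NoGPWithRatio k Is)
noGPWithRatio? k Is = all? (λ I → all? (λ J → all? (λ K → empty? (I *ᵢ k *ᵢ k ∩ᵢ J *ᵢ k ∩ᵢ K)) Is) Is) Is

∈ᵢ-*ᵢ-rescale : ∀ {n} I s k .{{_ : NonZero k}} → n ∈ᵢ I *ᵢ s → n * k ∈ᵢ I *ᵢ k *ᵢ s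
∈ᵢ-*ᵢ-rescale {n} I s k n∈ = subst (n * k ∈ᵢ_) (*ᵢ-comm I s k) (∈ᵢ-*ᵢ (I *ᵢ s) k n∈)

noGP-in-intervals : ∀ {k} .{{_ : NonZero k}} I J K s → Empty (I *ᵢ k *ᵢ k ∩ᵢ J *ᵢ k ∩ᵢ K) → ∀ {a} →
  a ∈ᵢ I *ᵢ s → a * k ∈ᵢ J *ᵢ s → ¬ a * k * k ∈ᵢ K *ᵢ s
noGP-in-intervals {k} I J K s empty {a} a∈ ak∈ akk∈ =
  Empty⇒∉ᵢ _ (Empty-*ᵢ _ s empty) (subst (a * k * k ∈ᵢ_) ∩ᵢ-rescale akk∈∩)
  where
  ∩ᵢ-rescale : I *ᵢ k *ᵢ k *ᵢ s ∩ᵢ J *ᵢ k *ᵢ s ∩ᵢ K *ᵢ s ≡ (I *ᵢ k *ᵢ k ∩ᵢ J *ᵢ k ∩ᵢ K) *ᵢ s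
  ∩ᵢ-rescale = sym (trans (*ᵢ-∩ᵢ (I *ᵢ k *ᵢ k) (J *ᵢ k ∩ᵢ K) s) (cong (I *ᵢ k *ᵢ k *ᵢ s ∩ᵢ_) (*ᵢ-∩ᵢ (J *ᵢ k) K s)))
  akk∈∩ : a * k * k ∈ᵢ I *ᵢ k *ᵢ k *ᵢ s ∩ᵢ J *ᵢ k *ᵢ s ∩ᵢ K *ᵢ s
  akk∈∩ = ∈ᵢ-∩ᵢ (I *ᵢ k *ᵢ k *ᵢ s) _ (∈ᵢ-*ᵢ-rescale (I *ᵢ k) s k (∈ᵢ-*ᵢ-rescale I s k a∈))
            (∈ᵢ-∩ᵢ (J *ᵢ k *ᵢ s) (K *ᵢ s) (∈ᵢ-*ᵢ-rescale J s k ak∈) akk∈)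

NoGPWithRatio⇒noGP : ∀ {k} .{{_ : NonZero k}} Is s → NoGPWithRatio k Is → ∀ {a} →
  Any (a ∈ᵢ_) (map (_*ᵢ s) Is) → Any (a * k ∈ᵢ_) (map (_*ᵢ s) Is) →
  ¬ Any (a * k * k ∈ᵢ_) (map (_*ᵢ s) Is)
NoGPWithRatio⇒noGP Is s noGP a∈ ak∈ akk∈
  with I , I∈ , a∈I ← find (map⁻ a∈)
     | J , J∈ , ak∈J ← find (map⁻ ak∈)
     | K , K∈ , akk∈K ← find (map⁻ akk∈)
  = noGP-in-intervals I J K s (lookup (lookup (lookup noGP I∈) J∈) K∈) a∈I ak∈J akk∈K

base : List Interval
base = (1080 , 4320) ∷ (480 , 540) ∷ (180 , 360) ∷ (135 , 160) ∷ (108 , 120) ∷ (90 , 96) ∷ []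

Block : ℕ → ℕ → Set
Block s n = Any (n ∈ᵢ_) (map (_*ᵢ s) base)

block? : ∀ s n → Dec (Block s n)
block? s n = any? (n ∈ᵢ?_) (map (_*ᵢ s) base)

Block-bounds : ∀ s {n} → Block s n → n ∈ᵢ (90 , 4320) *ᵢ s
Block-bounds s n∈
  with I , I∈ , n∈I ← find (map⁻ n∈)
  = ∈ᵢ-⊆ᵢ (I *ᵢ s) _ (⊆ᵢ-*ᵢ I (90 , 4320) s (lookup base⊆ I∈)) n∈I
  where
  base⊆ : All (_⊆ᵢ (90 , 4320)) base
  base⊆ = toWitness {a? = all? (_⊆ᵢ? (90 , 4320)) base} tt

ratio<48 : ∀ s {a k} .{{_ : NonZero k}} → 90 * s < a → a * k ≤ 4320 * s → k < 48
ratio<48 s {a} {k} 90s<a ak≤4320s = *-cancelʳ-< (90 * s) k 48 (begin-strict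
  k * (90 * s)  ≡⟨ *-comm k (90 * s) ⟩
  90 * s * k    <⟨ *-monoˡ-< k 90s<a ⟩
  a * k         ≤⟨ ak≤4320s ⟩
  4320 * s      ≡⟨ *-assoc 48 90 s ⟩
  48 * (90 * s) ∎)
  where open ≤-Reasoning

small-ratios : ∀ {k} → k < 7 → 1 < k → NoGPWithRatio k base
small-ratios = toWitness {a? = allUpTo? (λ k → 1 <? k →-dec noGPWithRatio? k base) 7} tt

square<49⇒<7 : ∀ {k} → k * k < 49 → k < 7
square<49⇒<7 k²<49 = ≰⇒> (λ 7≤k → <⇒≱ k²<49 (*-mono-≤ 7≤k 7≤k))

noGP-in-block : ∀ {s a k} .{{_ : NonZero k}} → 1 < k →
  Block s a → Block s (a * k) → ¬ Block s (a * k * k)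
noGP-in-block {s} {a} {k} 1<k a∈ ak∈ akk∈ =
  NoGPWithRatio⇒noGP base s (small-ratios (square<49⇒<7 (m<n⇒m<1+n k²<48)) 1<k) a∈ ak∈ akk∈
  where
  k²<48 : k * k < 48
  k²<48 = ratio<48 s {{m*n≢0 k k}} (proj₁ (Block-bounds s a∈))
            (subst (_≤ 4320 * s) (*-assoc a k k) (proj₂ (Block-bounds s akk∈)))

scale : ℕ → ℕ
scale zero    = 1
scale (suc j) = scale j * scale j * 207360

scale-nonZero : ∀ j → NonZero (scale j)
scale-nonZero zero    = _
scale-nonZero (suc j) = m*n≢0 (s * s) 207360 {{m*n≢0 s s {{scale-nonZero j}} {{scale-nonZero j}}}}
  where
  s : ℕ
  s = scale j

scale-< : ∀ j → scale j < scale (suc j)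
scale-< j = ≤-<-trans (m≤m*n s s) (m<m*n (s * s) 207360 {{m*n≢0 s s}} (s≤s (s≤s z≤n)))
  where
  s : ℕ
  s = scale j
  instance
    s≢0 : NonZero s
    s≢0 = scale-nonZero j

j<scale : ∀ j → j < scale j
j<scale zero    = z<s
j<scale (suc j) = ≤-<-trans (j<scale j) (scale-< j)

top²≡next-bottom : ∀ s → 4320 * s * (4320 * s) ≡ 90 * (s * s * 207360)
top²≡next-bottom = solve-∀

scale-gap : ∀ {i j} → i < j → 4320 * scale i * (4320 * scale i) ≤ 90 * scale j
scale-gap {i} {suc j} i<1+j with m<1+n⇒m<n∨m≡n i<1+j
... | inj₁ i<j  = ≤-trans (scale-gap i<j) (*-monoʳ-≤ 90 (<⇒≤ (scale-< j)))
... | inj₂ refl = ≤-reflexive (top²≡next-bottom (scale i))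

scale-gap-48 : ∀ {i j} → i < j → 4320 * scale i * 48 ≤ 90 * scale j
scale-gap-48 {i} i<j = ≤-trans (*-monoʳ-≤ (4320 * scale i) 48≤top) (scale-gap i<j)
  where
  48≤top : 48 ≤ 4320 * scale i
  48≤top = ≤-trans (toWitness {a? = 48 ≤? 4320} tt) (m≤m*n 4320 (scale i) {{scale-nonZero i}})

blocks-ordered : ∀ {i j m n} → i < j → Block (scale i) m → Block (scale j) n → m < n
blocks-ordered {i} {j} {m} {n} i<j m∈ n∈ = begin-strict
  m                   ≤⟨ proj₂ (Block-bounds (scale i) m∈) ⟩
  4320 * scale i      ≤⟨ m≤m*n (4320 * scale i) 48 ⟩
  4320 * scale i * 48 ≤⟨ scale-gap-48 i<j ⟩
  90 * scale j        <⟨ proj₁ (Block-bounds (scale j) n∈) ⟩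
  n                   ∎
  where open ≤-Reasoning

ak²≤[ak]² : ∀ a k .{{_ : NonZero a}} → a * k * k ≤ a * k * (a * k)
ak²≤[ak]² a k = *-monoʳ-≤ (a * k) (m≤n*m k a)

noGP-last-in-higher-block : ∀ {i j a k} .{{_ : NonZero a}} → i < j →
  Block (scale i) (a * k) → ¬ Block (scale j) (a * k * k)
noGP-last-in-higher-block {i} {j} {a} {k} i<j ak∈ akk∈ = <-irrefl refl (begin-strict
  a * k * k                         ≤⟨ ak²≤[ak]² a k ⟩
  a * k * (a * k)                   ≤⟨ *-mono-≤ ak≤top ak≤top ⟩
  4320 * scale i * (4320 * scale i) ≤⟨ scale-gap i<j ⟩
  90 * scale j                      <⟨ proj₁ (Block-bounds (scale j) akk∈) ⟩
  a * k * k                         ∎)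
  where
  open ≤-Reasoning
  ak≤top : a * k ≤ 4320 * scale i
  ak≤top = proj₂ (Block-bounds (scale i) ak∈)

noGP-first-in-lower-block : ∀ {i j a k} .{{_ : NonZero k}} → i < j →
  Block (scale i) a → Block (scale j) (a * k) → ¬ Block (scale j) (a * k * k)
noGP-first-in-lower-block {i} {j} {a} {k} i<j a∈ ak∈ akk∈ = <-irrefl refl (begin-strict
  a * k               ≤⟨ *-mono-≤ (proj₂ (Block-bounds (scale i) a∈)) (<⇒≤ k<48) ⟩
  4320 * scale i * 48 ≤⟨ scale-gap-48 i<j ⟩
  90 * scale j        <⟨ proj₁ (Block-bounds (scale j) ak∈) ⟩
  a * k               ∎)
  where
  open ≤-Reasoning
  k<48 : k < 48
  k<48 = ratio<48 (scale j) (proj₁ (Block-bounds (scale j) ak∈)) (proj₂ (Block-bounds (scale j) akk∈))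

InSomeBlock : ℕ → Set
InSomeBlock n = ∃[ j ] Block (scale j) n

noGP-in-blocks : ∀ {a k} .{{_ : NonZero a}} .{{_ : NonZero k}} → 1 < k →
  InSomeBlock a → InSomeBlock (a * k) → ¬ InSomeBlock (a * k * k)
noGP-in-blocks {a} {k} 1<k (i₁ , a∈) (i₂ , ak∈) (i₃ , akk∈) with <-cmp i₂ i₃
... | tri< i₂<i₃ _ _ = noGP-last-in-higher-block i₂<i₃ ak∈ akk∈
... | tri> _ _ i₃<i₂ = <⇒≱ (blocks-ordered i₃<i₂ akk∈ ak∈) (m≤m*n (a * k) k)
... | tri≈ _ refl _ with <-cmp i₁ i₂
...   | tri< i₁<i₂ _ _ = noGP-first-in-lower-block i₁<i₂ a∈ ak∈ akk∈
...   | tri> _ _ i₂<i₁ = <⇒≱ (blocks-ordered i₂<i₁ ak∈ a∈) (m≤m*n a k)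
...   | tri≈ _ refl _  = noGP-in-block {scale i₁} 1<k a∈ ak∈ akk∈

-- n can only lie in blocks of scale j < n, since Block (scale j) n forces j < scale j < n.
search : ∀ n → Dec (∃[ j ] j < n × Block (scale j) n)
search n = anyUpTo? (λ j → block? (scale j) n) n

A : Subset
A n = ⌊ search n ⌋

A-sound : ∀ {n} → A n ≡ true → InSomeBlock n
A-sound {n} n∈A with j , _ , n∈ ← toWitness {a? = search n} (Equivalence.from T-≡ n∈A) = j , n∈

A-complete : ∀ {j n} → Block (scale j) n → A n ≡ true
A-complete {j} {n} n∈ = Equivalence.to T-≡ (fromWitness {a? = search n} (j , j<n , n∈))
  where
  j<n : j < n
  j<n = <-trans (<-≤-trans (j<scale j) (m≤n*m (scale j) 90)) (proj₁ (Block-bounds (scale j) n∈))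

A-noGP3 : NoGP3 A
A-noGP3 a k a≥1 k≥2 (a∈A , ak∈A , akk∈A) =
  noGP-in-blocks {{>-nonZero a≥1}} {{>-nonZero (<-trans z<s k≥2)}} k≥2
    (A-sound a∈A) (A-sound ak∈A) (A-sound akk∈A)

A-count : ∀ j → 3523 * scale j ≤ count A (4320 * scale j)
A-count j = subst (_≤ count A (4320 * scale j)) (total-*ᵢ base (scale j))
  (count-≥-total A (map (_*ᵢ scale j) base) (Descending-*ᵢ base (scale j) base-descending) (A-complete {j}))
  where
  base-descending : Descending 4320 base
  base-descending = toWitness {a? = descending? 4320 base} tt

theorem3p1 : ∃[ A ] (PositiveSet A × NoGP3 A × UpperDensityGt A 815509 1000000)
theorem3p1 = A , refl , A-noGP3 , 3523 , 4320 , s≤s z≤n , 3523/4320>0·815509 , dense-at-block-tops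
  where
  3523/4320>0·815509 : 3523 * 1000000 > 815509 * 4320
  3523/4320>0·815509 = toWitness {a? = 815509 * 4320 <? 3523 * 1000000} tt
  dense-at-block-tops : ∀ M → ∃[ N ] (N ≥ M × N ≥ 1 × count A N * 4320 ≥ 3523 * N)
  dense-at-block-tops M =
    N , ≤-trans (<⇒≤ (j<scale M)) s≤N , ≤-trans (>-nonZero⁻¹ s {{scale-nonZero M}}) s≤N , (begin
    3523 * (4320 * s) ≡⟨ cong (3523 *_) (*-comm 4320 s) ⟩
    3523 * (s * 4320) ≡⟨ *-assoc 3523 s 4320 ⟨
    3523 * s * 4320   ≤⟨ *-monoˡ-≤ 4320 (A-count M) ⟩
    count A N * 4320  ∎)
    where
    open ≤-Reasoning
    s N : ℕ
    s = scale M
    N = 4320 * s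
    s≤N : s ≤ N
    s≤N = m≤n*m s 4320
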